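{- For all integers $n\ge 4$, $$\sum_{j=0}^{\lfloor n/2\rfloor}\chi^{(n-j,j)}\big(4\,1^{n-4}\big)^2=\frac{n^4-26n^3+299n^2-1354n+2100}{4(2n-1)(2n-3)(2n-5)(2n-7)(n+1)}\binom{2n}{n}.$$
   Context: For partitions $\lambda,\mu$ of $n$, $\chi^{\lambda}(\mu)$ is the value of the irreducible character of $S_n$ indexed by $\lambda$ on permutations of cycle type $\mu$. $(n-j,j)$ is the shape with rows $n-j$ and $j$ (one row when $j=0$); $4\,1^{n-4}$ is the partition of $n$ with one part $4$ and $n-4$ parts $1$. -}

module Defs where

open import Data.Nat as ℕ using (ℕ; zero; suc; _∸_; _≡ᵇ_; _≤ᵇ_; _<ᵇ_)
open import Data.Nat.DivMod using (_/_)
open import Data.Integer as ℤ using (ℤ; +_; -_)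
open import Data.List using (List; []; _∷_; length; map; replicate; upTo; foldr)
open import Data.Nat.ListAction using (sum)
open import Data.Bool using (Bool; true; false; if_then_else_; _∧_; not)
open import Data.Product using (_×_; _,_; proj₁; proj₂)

-- Characters of S_n via the Murnaghan–Nakayama rule, phrased with beta-sets
-- (first-column hook lengths).  A partition λ = (λ₀ ≥ λ₁ ≥ … ≥ λ_{ℓ-1}) is
-- encoded by its beta-set { λ_i + (ℓ-1-i) }.  Removing a rim hook of size k
-- corresponds to replacing some β by β-k (when β-k ≥ 0 is not already in the
-- set); the leg length equals the number of beta-numbers strictly between
-- β-k and β.

betaSet : List ℕ → List ℕ
betaSet lam = go (length lam) lam
  where
  go : ℕ → List ℕ → List ℕ
  go _ [] = []
  go zero (_ ∷ _) = []
  go (suc l) (x ∷ xs) = (x ℕ.+ l) ∷ go l xs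

mem : ℕ → List ℕ → Bool
mem a [] = false
mem a (x ∷ xs) = if a ≡ᵇ x then true else mem a xs

between : ℕ → ℕ → List ℕ → ℕ
between a b [] = 0
between a b (x ∷ xs) = if (a <ᵇ x) ∧ (x <ᵇ b) then suc (between a b xs) else between a b xs

sgn : ℕ → ℤ
sgn zero = + 1
sgn (suc h) = - sgn h

replaceBy : ℕ → ℕ → List ℕ → List ℕ
replaceBy b c S = map (λ x → if x ≡ᵇ b then c else x) S

rims : ℕ → List ℕ → List ℕ → List (ℤ × List ℕ)
rims k S [] = []
rims k S (b ∷ bs) =
  if (k ≤ᵇ b) ∧ not (mem (b ∸ k) S)
  then (sgn (between (b ∸ k) b S) , replaceBy b (b ∸ k) S) ∷ rims k S bs
  else rims k S bs

sumℤ : List ℤ → ℤ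
sumℤ = foldr ℤ._+_ (+ 0)

-- the beta-set S encodes the empty partition iff S = {0,…,ℓ-1}, i.e. (S being
-- a set of distinct naturals) iff 2·ΣS = ℓ(ℓ-1)
isEmptyβ : List ℕ → Bool
isEmptyβ S = (2 ℕ.* sum S) ≡ᵇ (length S ℕ.* (length S ∸ 1))

chiβ : List ℕ → List ℕ → ℤ
chiβ S [] = if isEmptyβ S then + 1 else + 0
chiβ S (k ∷ μ) = sumℤ (map (λ p → proj₁ p ℤ.* chiβ (proj₂ p) μ) (rims k S S))

-- χ^λ(μ): λ a partition (weakly decreasing list), μ the list of cycle lengths
χ : List ℕ → List ℕ → ℤ
χ lam μ = chiβ (betaSet lam) μ

twoRow : ℕ → ℕ → List ℕ
twoRow n zero = n ∷ []
twoRow n (suc j) = (n ∸ suc j) ∷ suc j ∷ []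

cycleType41 : ℕ → List ℕ
cycleType41 n = 4 ∷ replicate (n ∸ 4) 1

lhsSum : ℕ → ℤ
lhsSum n = sumℤ (map (λ j → χ (twoRow n j) (cycleType41 n) ℤ.* χ (twoRow n j) (cycleType41 n)) (upTo (suc (n / 2))))

{-# OPTIONS --safe #-}
-- Write m = n - 4 and b_m(q) = C(m,q) - C(m,q-1) = χ^{(m-q,q)}(1^m).  By the
-- Murnaghan–Nakayama rule (in beta-set form) removing a 4-hook from (m+4-j, j)
-- gives χ^{(n-j,j)}(4 1^m) = e_j := b_m(j) + b_m(j-4), the leg sign of the one
-- crossing removal being absorbed by the antisymmetry of b_m about (m+1)/2.
-- Then e is antisymmetric under j ↦ m+5-j, so twice the sum is Σ_{j=0}^{m+5} e_j².
-- Expanding the squares and using Vandermonde, Σ_j C(m,j) C(m,j+k) = C(2m,m+k),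
-- gives 4c₀ - 4c₁ - 2c₃ + 4c₄ - 2c₅ with c_k = C(2m,m+k).  Each c_k and C(2n,n)
-- is a rational multiple of C(2m,m), and clearing the denominators
-- (m+1)⋯(m+5) leaves a polynomial identity in m.

module Submission where

open import Defs
open import Data.Nat using (ℕ; _≤_)
open import Data.Nat.Combinatorics using (_C_)
open import Data.Integer using (ℤ; +_; _+_; _-_; _*_; _^_)
open import Relation.Binary.PropositionalEquality using (_≡_)

open import Data.Nat as ℕ using (zero; suc; _<_; z≤n; s≤s; _≡ᵇ_; _<ᵇ_; _≤ᵇ_; _∸_; _≟_; _<?_; _≤?_)
import Data.Nat.Properties as ℕ
open import Data.Nat.Combinatorics using (nCk+nC[k+1]≡[n+1]C[k+1]; nCk≡nC[n∸k]; nCn≡1; nC1≡n; k>n⇒nCk≡0)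
open import Data.Nat.DivMod using (_/_; _%_; m≡m%n+[m/n]*n; m%n<n)
open import Data.Integer using (-_; -1ℤ)
import Data.Integer.Properties as ℤ
open import Data.Integer.Tactic.RingSolver using (solve-∀)
import Data.Nat.Tactic.RingSolver as ℕ-Solver
open import Data.Bool using (true; false; if_then_else_; _∧_; not)
open import Data.Bool.Properties using (∧-zeroʳ)
open import Data.List using (List; []; _∷_; map; replicate; upTo; applyUpTo)
open import Data.List.Membership.Propositional using (_∈_; _∉_)
open import Data.List.Relation.Unary.Any using (here; there)
open import Data.Product using (_,_; proj₁; proj₂)
open import Data.Sum using (_⊎_; inj₁; inj₂; [_,_]′)
open import Function using (_∘_)
open import Relation.Binary.Definitions using (Tri; tri<; tri≈; tri>)
open import Relation.Binary.PropositionalEquality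
  using (_≢_; refl; sym; trans; cong; cong₂; subst; subst₂; module ≡-Reasoning)
open import Relation.Nullary using (Dec; yes; no)
open import Relation.Nullary.Decidable using (dec-true; dec-false)

open ≡-Reasoning

-- Finite sums and shifts

∑ : ℕ → (ℕ → ℤ) → ℤ
∑ zero    f = + 0
∑ (suc L) f = f 0 + ∑ L (f ∘ suc)

syntax ∑ L (λ j → e) = ∑[ j < L ] e

∑-cong-< : ∀ L {f h : ℕ → ℤ} → (∀ {j} → j < L → f j ≡ h j) → ∑ L f ≡ ∑ L h
∑-cong-< zero    eq = refl
∑-cong-< (suc L) eq = cong₂ _+_ (eq (s≤s z≤n)) (∑-cong-< L (eq ∘ s≤s))

∑-cong : ∀ L {f h : ℕ → ℤ} → (∀ j → f j ≡ h j) → ∑ L f ≡ ∑ L h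
∑-cong L eq = ∑-cong-< L (λ {j} _ → eq j)

∑-distrib-+ : ∀ L (f h : ℕ → ℤ) → ∑[ j < L ] (f j + h j) ≡ ∑ L f + ∑ L h
∑-distrib-+ zero    f h = refl
∑-distrib-+ (suc L) f h = begin
  (f 0 + h 0) + ∑[ j < L ] (f (suc j) + h (suc j))  ≡⟨ cong (_+_ (f 0 + h 0)) (∑-distrib-+ L (f ∘ suc) (h ∘ suc)) ⟩
  (f 0 + h 0) + (∑ L (f ∘ suc) + ∑ L (h ∘ suc))     ≡⟨ interchange (f 0) (h 0) _ _ ⟩
  (f 0 + ∑ L (f ∘ suc)) + (h 0 + ∑ L (h ∘ suc))     ∎
  where
  interchange : ∀ a b x y → (a + b) + (x + y) ≡ (a + x) + (b + y)
  interchange = solve-∀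

∑-neg : ∀ L (f : ℕ → ℤ) → ∑[ j < L ] (- f j) ≡ - ∑ L f
∑-neg zero    f = refl
∑-neg (suc L) f = trans (cong (_+_ (- f 0)) (∑-neg L (f ∘ suc))) (sym (ℤ.neg-distrib-+ (f 0) _))

∑-distrib-- : ∀ L (f h : ℕ → ℤ) → ∑[ j < L ] (f j - h j) ≡ ∑ L f - ∑ L h
∑-distrib-- L f h = trans (∑-distrib-+ L f (-_ ∘ h)) (cong (_+_ (∑ L f)) (∑-neg L h))

∑-split : ∀ a b (f : ℕ → ℤ) → ∑ (a ℕ.+ b) f ≡ ∑ a f + ∑[ i < b ] f (a ℕ.+ i)
∑-split zero    b f = sym (ℤ.+-identityˡ _)
∑-split (suc a) b f = trans (cong (_+_ (f 0)) (∑-split a b (f ∘ suc))) (sym (ℤ.+-assoc (f 0) _ _))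

∑-snoc : ∀ L (f : ℕ → ℤ) → ∑ (suc L) f ≡ ∑ L f + f L
∑-snoc zero    f = ℤ.+-comm (f 0) (+ 0)
∑-snoc (suc L) f = trans (cong (_+_ (f 0)) (∑-snoc L (f ∘ suc))) (sym (ℤ.+-assoc (f 0) _ _))

∑-reverse : ∀ L (f h : ℕ → ℤ) → (∀ i j → suc (i ℕ.+ j) ≡ L → f i ≡ h j) → ∑ L f ≡ ∑ L h
∑-reverse zero    f h eq = refl
∑-reverse (suc L) f h eq = begin
  ∑ (suc L) f                 ≡⟨ ∑-snoc L f ⟩
  ∑ L f + f L                 ≡⟨ cong₂ _+_ (∑-reverse L f (h ∘ suc) eq′) (eq L 0 (cong suc (ℕ.+-identityʳ L))) ⟩
  ∑ L (h ∘ suc) + h 0         ≡⟨ ℤ.+-comm _ (h 0) ⟩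
  ∑ (suc L) h                 ∎
  where
  eq′ : ∀ i j → suc (i ℕ.+ j) ≡ L → f i ≡ h (suc j)
  eq′ i j i+j+1≡L = eq i (suc j) (cong suc (trans (ℕ.+-suc i j) i+j+1≡L))

∑-upTo : ∀ L (f : ℕ → ℤ) → sumℤ (map f (upTo L)) ≡ ∑ L f
∑-upTo L f = go L (λ j → j)
  where
  go : ∀ L (g : ℕ → ℕ) → sumℤ (map f (applyUpTo g L)) ≡ ∑[ j < L ] f (g j)
  go zero    g = refl
  go (suc L) g = cong (_+_ (f (g 0))) (go L (g ∘ suc))

shift : ℕ → (ℕ → ℤ) → ℕ → ℤ
shift zero    f j       = f j
shift (suc d) f zero    = + 0
shift (suc d) f (suc j) = shift d f j

shift-below : ∀ {d j} (f : ℕ → ℤ) → j < d → shift d f j ≡ + 0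
shift-below {suc d} {zero}  f _           = refl
shift-below {suc d} {suc j} f (s≤s j<d) = shift-below f j<d

shift-+ : ∀ d j (f : ℕ → ℤ) → shift d f (d ℕ.+ j) ≡ f j
shift-+ zero    j f = refl
shift-+ (suc d) j f = shift-+ d j f

shift-shift : ∀ a b (f : ℕ → ℤ) j → shift a (shift b f) j ≡ shift (a ℕ.+ b) f j
shift-shift zero    b f j       = refl
shift-shift (suc a) b f zero    = refl
shift-shift (suc a) b f (suc j) = shift-shift a b f j

shift-distrib-- : ∀ d (f h : ℕ → ℤ) j → shift d (λ i → f i - h i) j ≡ shift d f j - shift d h j
shift-distrib-- zero    f h j       = refl
shift-distrib-- (suc d) f h zero    = refl
shift-distrib-- (suc d) f h (suc j) = shift-distrib-- d f h j

∑-shift-both : ∀ d L (f h : ℕ → ℤ) → ∑[ j < d ℕ.+ L ] (shift d f j * shift d h j) ≡ ∑[ j < L ] (f j * h j)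
∑-shift-both zero    L f h = refl
∑-shift-both (suc d) L f h = trans (ℤ.+-identityˡ _) (∑-shift-both d L f h)

∑-shiftʳ : ∀ d L (f h : ℕ → ℤ) → ∑[ j < d ℕ.+ L ] (f j * shift d h j) ≡ ∑[ j < L ] (f (d ℕ.+ j) * h j)
∑-shiftʳ zero    L f h = refl
∑-shiftʳ (suc d) L f h =
  trans (cong (_+ ∑[ j < d ℕ.+ L ] (f (suc j) * shift d h j)) (ℤ.*-zeroʳ (f 0)))
        (trans (ℤ.+-identityˡ _) (∑-shiftʳ d L (f ∘ suc) h))

∑-expand : ∀ L (x y u v : ℕ → ℤ) →
  ∑[ j < L ] ((x j - y j) * (u j - v j))
    ≡ ((∑[ j < L ] (x j * u j) - ∑[ j < L ] (x j * v j)) - ∑[ j < L ] (y j * u j)) + ∑[ j < L ] (y j * v j)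
∑-expand L x y u v = begin
  ∑[ j < L ] ((x j - y j) * (u j - v j))
    ≡⟨ ∑-cong L (λ j → expand (x j) (y j) (u j) (v j)) ⟩
  ∑[ j < L ] (((x j * u j - x j * v j) - y j * u j) + y j * v j)
    ≡⟨ ∑-distrib-+ L (λ j → (x j * u j - x j * v j) - y j * u j) (λ j → y j * v j) ⟩
  ∑[ j < L ] ((x j * u j - x j * v j) - y j * u j) + ∑[ j < L ] (y j * v j)
    ≡⟨ cong (_+ ∑[ j < L ] (y j * v j)) (trans (∑-distrib-- L (λ j → x j * u j - x j * v j) (λ j → y j * u j))
                                          (cong (_- ∑[ j < L ] (y j * u j)) (∑-distrib-- L (λ j → x j * u j) (λ j → x j * v j)))) ⟩
  ((∑[ j < L ] (x j * u j) - ∑[ j < L ] (x j * v j)) - ∑[ j < L ] (y j * u j)) + ∑[ j < L ] (y j * v j) ∎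
  where
  expand : ∀ x y u v → (x - y) * (u - v) ≡ ((x * u - x * v) - y * u) + y * v
  expand = solve-∀

-- Rows of Pascal's triangle and Vandermonde's identity

row : ℕ → ℕ → ℤ
row n k = + (n C k)

row-0 : ∀ n → row n 0 ≡ + 1
row-0 n = cong +_ (trans (nCk≡nC[n∸k] {0} {n} z≤n) (nCn≡1 n))

row-diagonal : ∀ n → row n n ≡ + 1
row-diagonal n = cong +_ (nCn≡1 n)

row-above : ∀ {n k} → n < k → row n k ≡ + 0
row-above n<k = cong +_ (k>n⇒nCk≡0 n<k)

row-symmetric : ∀ {n} a b → a ℕ.+ b ≡ n → row n a ≡ row n b
row-symmetric a b refl =
  cong +_ (trans (nCk≡nC[n∸k] (ℕ.m≤m+n a b)) (cong ((a ℕ.+ b) C_) (ℕ.m+n∸m≡n a b)))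

row-pascal : ∀ n k → row (suc n) (suc k) ≡ row n k + row n (suc k)
row-pascal n k = cong +_ (sym (nCk+nC[k+1]≡[n+1]C[k+1] n k))

row-suc : ∀ n j → row (suc n) j ≡ row n j + shift 1 (row n) j
row-suc n zero    = trans (row-0 (suc n)) (sym (trans (ℤ.+-identityʳ _) (row-0 n)))
row-suc n (suc j) = trans (row-pascal n j) (ℤ.+-comm (row n j) (row n (suc j)))

∑-zero : ∀ L → ∑[ j < L ] (+ 0) ≡ + 0
∑-zero zero    = refl
∑-zero (suc L) = trans (ℤ.+-identityˡ _) (∑-zero L)

vandermonde : ∀ a b k L → a < L → ∑[ j < L ] (row a j * row b (j ℕ.+ k)) ≡ row (a ℕ.+ b) (a ℕ.+ k)
vandermonde zero b k (suc L) _ =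
  trans (cong₂ _+_ (ℤ.*-identityˡ (row b k)) (∑-zero L)) (ℤ.+-identityʳ _)
vandermonde (suc a) b k (suc L) (s≤s a<L) = begin
  ∑[ j < suc L ] (row (suc a) j * row b (j ℕ.+ k))
    ≡⟨ ∑-cong (suc L) (λ j → trans (cong (_* row b (j ℕ.+ k)) (row-suc a j))
                                   (ℤ.*-distribʳ-+ (row b (j ℕ.+ k)) (row a j) (shift 1 (row a) j))) ⟩
  ∑[ j < suc L ] (row a j * row b (j ℕ.+ k) + shift 1 (row a) j * row b (j ℕ.+ k))
    ≡⟨ ∑-distrib-+ (suc L) (λ j → row a j * row b (j ℕ.+ k)) (λ j → shift 1 (row a) j * row b (j ℕ.+ k)) ⟩
  ∑[ j < suc L ] (row a j * row b (j ℕ.+ k)) + (+ 0 + ∑[ j < L ] (row a j * row b (suc j ℕ.+ k)))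
    ≡⟨ cong₂ _+_ (vandermonde a b k (suc L) (ℕ.m<n⇒m<1+n a<L)) (trans (ℤ.+-identityˡ _) shifted) ⟩
  row (a ℕ.+ b) (a ℕ.+ k) + row (a ℕ.+ b) (suc (a ℕ.+ k))
    ≡⟨ row-pascal (a ℕ.+ b) (a ℕ.+ k) ⟨
  row (suc a ℕ.+ b) (suc a ℕ.+ k) ∎
  where
  shifted : ∑[ j < L ] (row a j * row b (suc j ℕ.+ k)) ≡ row (a ℕ.+ b) (suc (a ℕ.+ k))
  shifted = begin
    ∑[ j < L ] (row a j * row b (suc j ℕ.+ k))
      ≡⟨ ∑-cong L (λ j → cong (λ i → row a j * row b i) (sym (ℕ.+-suc j k))) ⟩
    ∑[ j < L ] (row a j * row b (j ℕ.+ suc k))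
      ≡⟨ vandermonde a b (suc k) L a<L ⟩
    row (a ℕ.+ b) (a ℕ.+ suc k)
      ≡⟨ cong (row (a ℕ.+ b)) (ℕ.+-suc a k) ⟩
    row (a ℕ.+ b) (suc (a ℕ.+ k)) ∎

centred : ℕ → ℕ → ℤ
centred m k = row (m ℕ.+ m) (m ℕ.+ k)

∑-shifted-rows : ∀ m a b {L} → a ℕ.+ b ℕ.+ m < L →
  ∑[ j < L ] (shift a (row m) j * shift (a ℕ.+ b) (row m) j) ≡ centred m b
∑-shifted-rows m a b lt with ℕ.m≤n⇒∃[o]m+o≡n lt
... | o , refl = begin
  ∑[ j < suc (a ℕ.+ b ℕ.+ m) ℕ.+ o ] (shift a r j * shift (a ℕ.+ b) r j)
    ≡⟨ cong (λ L → ∑[ j < L ] (shift a r j * shift (a ℕ.+ b) r j)) (regroup a b m o) ⟩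
  ∑[ j < a ℕ.+ (b ℕ.+ L) ] (shift a r j * shift (a ℕ.+ b) r j)
    ≡⟨ ∑-cong (a ℕ.+ (b ℕ.+ L)) (λ j → cong (shift a r j *_) (sym (shift-shift a b r j))) ⟩
  ∑[ j < a ℕ.+ (b ℕ.+ L) ] (shift a r j * shift a (shift b r) j)
    ≡⟨ ∑-shift-both a (b ℕ.+ L) r (shift b r) ⟩
  ∑[ j < b ℕ.+ L ] (r j * shift b r j)
    ≡⟨ ∑-shiftʳ b L r r ⟩
  ∑[ j < L ] (r (b ℕ.+ j) * r j)
    ≡⟨ ∑-cong L (λ j → trans (ℤ.*-comm (r (b ℕ.+ j)) (r j)) (cong (λ i → r j * r i) (ℕ.+-comm b j))) ⟩
  ∑[ j < L ] (r j * r (j ℕ.+ b))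
    ≡⟨ vandermonde m m b L (s≤s (ℕ.m≤m+n m o)) ⟩
  centred m b ∎
  where
  r = row m
  L = suc (m ℕ.+ o)
  regroup : ∀ a b m o → suc (a ℕ.+ b ℕ.+ m) ℕ.+ o ≡ a ℕ.+ (b ℕ.+ suc (m ℕ.+ o))
  regroup = ℕ-Solver.solve-∀

-- Ballot numbers and their correlations

ballot : ℕ → ℕ → ℤ
ballot s q = row s q - shift 1 (row s) q

∑-ballot² : ∀ m {L} → suc m < L →
  ∑[ j < L ] (ballot m j * ballot m j) ≡ ((centred m 0 - centred m 1) - centred m 1) + centred m 0
∑-ballot² m {L} lt = begin
  ∑[ j < L ] (ballot m j * ballot m j)
    ≡⟨ ∑-expand L r (shift 1 r) r (shift 1 r) ⟩
  ((∑[ j < L ] (r j * r j) - ∑[ j < L ] (r j * shift 1 r j)) - ∑[ j < L ] (shift 1 r j * r j))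
    + ∑[ j < L ] (shift 1 r j * shift 1 r j)
    ≡⟨ cong₂ _+_ (cong₂ _-_ (cong₂ _-_ (∑-shifted-rows m 0 0 (ℕ.<-trans (ℕ.n<1+n m) lt))
                                        (∑-shifted-rows m 0 1 lt))
                             (trans (∑-cong L (λ j → ℤ.*-comm (shift 1 r j) (r j))) (∑-shifted-rows m 0 1 lt)))
                 (∑-shifted-rows m 1 0 lt) ⟩
  ((centred m 0 - centred m 1) - centred m 1) + centred m 0 ∎
  where r = row m

∑-ballot-lag : ∀ m d {L} → suc (suc d ℕ.+ m) < L →
  ∑[ j < L ] (ballot m j * shift (suc d) (ballot m) j)
    ≡ ((centred m (suc d) - centred m (suc (suc d))) - centred m d) + centred m (suc d)
∑-ballot-lag m d {L} lt = begin
  ∑[ j < L ] (ballot m j * shift (suc d) (ballot m) j)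
    ≡⟨ ∑-cong L (λ j → cong (ballot m j *_) (trans (shift-distrib-- (suc d) r (shift 1 r) j)
                                                    (cong (_-_ (shift (suc d) r j)) (shift-shift (suc d) 1 r j)))) ⟩
  ∑[ j < L ] (ballot m j * (shift (suc d) r j - shift (suc d ℕ.+ 1) r j))
    ≡⟨ ∑-expand L r (shift 1 r) (shift (suc d) r) (shift (suc d ℕ.+ 1) r) ⟩
  ((∑[ j < L ] (r j * shift (suc d) r j) - ∑[ j < L ] (r j * shift (suc d ℕ.+ 1) r j))
    - ∑[ j < L ] (shift 1 r j * shift (suc d) r j)) + ∑[ j < L ] (shift 1 r j * shift (suc d ℕ.+ 1) r j)
    ≡⟨ cong₂ _+_ (cong₂ _-_ (cong₂ _-_ (∑-shifted-rows m 0 (suc d) (ℕ.<-trans (ℕ.n<1+n _) lt))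
                                        (trans (∑-shifted-rows m 0 (suc d ℕ.+ 1) (bound (cong (ℕ._+ m) d+2≡)))
                                               (cong (centred m) d+2≡)))
                             (∑-shifted-rows m 1 d (ℕ.<-trans (ℕ.n<1+n _) lt)))
                 (trans (∑-shifted-rows m 1 (d ℕ.+ 1) (bound (cong (λ t → suc (t ℕ.+ m)) (ℕ.+-comm d 1))))
                        (cong (centred m) (ℕ.+-comm d 1))) ⟩
  ((centred m (suc d) - centred m (suc (suc d))) - centred m d) + centred m (suc d) ∎
  where
  r = row m
  d+2≡ : suc d ℕ.+ 1 ≡ suc (suc d)
  d+2≡ = cong suc (ℕ.+-comm d 1)
  bound : ∀ {k} → k ≡ suc (suc d ℕ.+ m) → k < L
  bound refl = lt

-- χ₄₁ m j is χ^{(m+4-j,j)}(4 1^m) whenever 2j ≤ m+4 (χ-twoRow-41).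
χ₄₁ : ℕ → ℕ → ℤ
χ₄₁ m j = ballot m j + shift 4 (ballot m) j

∑-χ₄₁² : ∀ m → let c = centred m in
  ∑[ j < 6 ℕ.+ m ] (χ₄₁ m j * χ₄₁ m j) ≡ + 4 * c 0 - + 4 * c 1 - + 2 * c 3 + + 4 * c 4 - + 2 * c 5
∑-χ₄₁² m = begin
  ∑[ j < L ] (χ₄₁ m j * χ₄₁ m j)
    ≡⟨ ∑-cong L (λ j → square-+ (g j) (g₄ j)) ⟩
  ∑[ j < L ] ((g j * g j + (g j * g₄ j + g j * g₄ j)) + g₄ j * g₄ j)
    ≡⟨ ∑-distrib-+ L (λ j → g j * g j + (g j * g₄ j + g j * g₄ j)) (λ j → g₄ j * g₄ j) ⟩
  ∑[ j < L ] (g j * g j + (g j * g₄ j + g j * g₄ j)) + ∑[ j < L ] (g₄ j * g₄ j)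
    ≡⟨ cong (_+ ∑[ j < L ] (g₄ j * g₄ j))
            (trans (∑-distrib-+ L (λ j → g j * g j) (λ j → g j * g₄ j + g j * g₄ j))
                   (cong (_+_ (∑[ j < L ] (g j * g j))) (∑-distrib-+ L (λ j → g j * g₄ j) (λ j → g j * g₄ j)))) ⟩
  (∑[ j < L ] (g j * g j) + (∑[ j < L ] (g j * g₄ j) + ∑[ j < L ] (g j * g₄ j))) + ∑[ j < L ] (g₄ j * g₄ j)
    ≡⟨ cong₂ _+_ (cong₂ _+_ (∑-ballot² m (ℕ.m≤n+m (2 ℕ.+ m) 4)) (cong₂ _+_ lag lag))
                 (trans (∑-shift-both 4 (2 ℕ.+ m) g g) (∑-ballot² m ℕ.≤-refl)) ⟩
  (B + (X + X)) + B
    ≡⟨ collect (c 0) (c 1) (c 3) (c 4) (c 5) ⟩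
  + 4 * c 0 - + 4 * c 1 - + 2 * c 3 + + 4 * c 4 - + 2 * c 5 ∎
  where
  L = 6 ℕ.+ m
  c = centred m
  g = ballot m
  g₄ = shift 4 (ballot m)
  B = ((c 0 - c 1) - c 1) + c 0
  X = ((c 4 - c 5) - c 3) + c 4
  lag : ∑[ j < L ] (g j * g₄ j) ≡ X
  lag = ∑-ballot-lag m 3 ℕ.≤-refl
  square-+ : ∀ x y → (x + y) * (x + y) ≡ (x * x + (x * y + x * y)) + y * y
  square-+ = solve-∀
  collect : ∀ c₀ c₁ c₃ c₄ c₅ → let b = ((c₀ - c₁) - c₁) + c₀ ; x = ((c₄ - c₅) - c₃) + c₄ in
    (b + (x + x)) + b ≡ + 4 * c₀ - + 4 * c₁ - + 2 * c₃ + + 4 * c₄ - + 2 * c₅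
  collect = solve-∀

-- Reflection antisymmetry and folding the sum

AntisymmetricAbout : ℕ → (ℕ → ℤ) → Set
AntisymmetricAbout c f = ∀ i j → i ℕ.+ j ≡ c → f i ≡ - f j

VanishesAbove : ℕ → (ℕ → ℤ) → Set
VanishesAbove c f = ∀ {i} → c < i → f i ≡ + 0

i≡-i⇒i≡0 : ∀ {i} → i ≡ - i → i ≡ + 0
i≡-i⇒i≡0 {+ zero} _ = refl

antisymmetric-centre : ∀ {c f} → AntisymmetricAbout c f → ∀ {i} → i ℕ.+ i ≡ c → f i ≡ + 0
antisymmetric-centre anti {i} eq = i≡-i⇒i≡0 (anti i i eq)

ballot-vanishes : ∀ s → VanishesAbove (suc s) (ballot s)
ballot-vanishes s {suc i} (s≤s s<i) = cong₂ _-_ (row-above (ℕ.m<n⇒m<1+n s<i)) (row-above s<i)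

ballot-antisymmetric : ∀ s → AntisymmetricAbout (suc s) (ballot s)
ballot-antisymmetric s zero    _    refl =
  trans (cong (_- + 0) (row-0 s)) (sym (cong₂ (λ x y → - (x - y)) (row-above (ℕ.n<1+n s)) (row-diagonal s)))
ballot-antisymmetric s (suc i) zero eq with ℕ.suc-injective (trans (sym (ℕ.+-identityʳ (suc i))) eq)
... | refl = sym (trans (cong -_ (ballot-antisymmetric s 0 (suc s) refl)) (ℤ.neg-involutive _))
ballot-antisymmetric s (suc i) (suc j) eq = begin
  row s (suc i) - row s i        ≡⟨ cong₂ _-_ (row-symmetric (suc i) j (trans (sym (ℕ.+-suc i j)) i+1+j≡s))
                                              (row-symmetric i (suc j) i+1+j≡s) ⟩
  row s j - row s (suc j)        ≡⟨ flip (row s j) (row s (suc j)) ⟩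
  - (row s (suc j) - row s j)    ∎
  where
  i+1+j≡s : i ℕ.+ suc j ≡ s
  i+1+j≡s = ℕ.suc-injective eq
  flip : ∀ x y → x - y ≡ - (y - x)
  flip = solve-∀

data ShiftView (d : ℕ) : ℕ → Set where
  below : ∀ {j} → j < d → ShiftView d j
  above : ∀ j → ShiftView d (d ℕ.+ j)

shiftView : ∀ d j → ShiftView d j
shiftView zero    j       = above j
shiftView (suc d) zero    = below (s≤s z≤n)
shiftView (suc d) (suc j) with shiftView d j
... | below j<d = below (s≤s j<d)
... | above j   = above j

cancel-shiftˡ : ∀ d x y {c} → (d ℕ.+ x) ℕ.+ y ≡ d ℕ.+ c → x ℕ.+ y ≡ c
cancel-shiftˡ d x y eq = ℕ.+-cancelˡ-≡ d _ _ (trans (sym (ℕ.+-assoc d x y)) eq)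

cancel-shiftʳ : ∀ d x y {c} → x ℕ.+ (d ℕ.+ y) ≡ d ℕ.+ c → x ℕ.+ y ≡ c
cancel-shiftʳ d x y eq = ℕ.+-cancelˡ-≡ d _ _ (trans (swap d x y) eq)
  where
  swap : ∀ d x y → d ℕ.+ (x ℕ.+ y) ≡ x ℕ.+ (d ℕ.+ y)
  swap = ℕ-Solver.solve-∀

+-shifted-antisymmetric : ∀ {c f} d → AntisymmetricAbout c f → VanishesAbove c f →
  AntisymmetricAbout (d ℕ.+ c) (λ j → f j + shift d f j)
+-shifted-antisymmetric {c} {f} d anti vanish i j eq with shiftView d i | shiftView d j
... | above i | above j = begin
  f (d ℕ.+ i) + shift d f (d ℕ.+ i)     ≡⟨ cong₂ _+_ (anti (d ℕ.+ i) j (cancel-shiftʳ d (d ℕ.+ i) j eq)) (shift-+ d i f) ⟩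
  - f j + f i                           ≡⟨ cong (_+_ (- f j)) (anti i (d ℕ.+ j) (cancel-shiftˡ d i (d ℕ.+ j) eq)) ⟩
  - f j + - f (d ℕ.+ j)                 ≡⟨ ℤ.+-comm (- f j) _ ⟩
  - f (d ℕ.+ j) + - f j                 ≡⟨ ℤ.neg-distrib-+ (f (d ℕ.+ j)) (f j) ⟨
  - (f (d ℕ.+ j) + f j)                 ≡⟨ cong (λ x → - (f (d ℕ.+ j) + x)) (shift-+ d j f) ⟨
  - (f (d ℕ.+ j) + shift d f (d ℕ.+ j)) ∎
... | below i<d | above j = begin
  f i + shift d f i                     ≡⟨ cong₂ _+_ (anti i j (cancel-shiftʳ d i j eq)) (shift-below f i<d) ⟩
  - f j + + 0                           ≡⟨ ℤ.+-identityʳ (- f j) ⟩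
  - f j                                 ≡⟨ cong -_ (ℤ.+-identityˡ (f j)) ⟨
  - (+ 0 + f j)                         ≡⟨ cong₂ (λ x y → - (x + y)) (vanish c<d+j) (shift-+ d j f) ⟨
  - (f (d ℕ.+ j) + shift d f (d ℕ.+ j)) ∎
  where
  c<d+j : c < d ℕ.+ j
  c<d+j = subst (_< d ℕ.+ j) (cancel-shiftʳ d i j eq) (ℕ.+-monoˡ-< j i<d)
... | above i | below j<d = begin
  f (d ℕ.+ i) + shift d f (d ℕ.+ i)     ≡⟨ cong₂ _+_ (vanish c<d+i) (shift-+ d i f) ⟩
  + 0 + f i                             ≡⟨ ℤ.+-identityˡ (f i) ⟩
  f i                                   ≡⟨ anti i j (cancel-shiftˡ d i j eq) ⟩
  - f j                                 ≡⟨ cong -_ (ℤ.+-identityʳ (f j)) ⟨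
  - (f j + + 0)                         ≡⟨ cong (λ x → - (f j + x)) (shift-below f j<d) ⟨
  - (f j + shift d f j)                 ∎
  where
  c<d+i : c < d ℕ.+ i
  c<d+i = subst₂ _<_ (cancel-shiftˡ d i j eq) (ℕ.+-comm i d) (ℕ.+-monoʳ-< i j<d)
... | below i<d | below j<d = begin
  f i + shift d f i                     ≡⟨ cong₂ _+_ (vanish (beyond j<d eq)) (shift-below f i<d) ⟩
  + 0                                   ≡⟨ cong₂ (λ x y → - (x + y)) (vanish (beyond i<d (trans (ℕ.+-comm j i) eq))) (shift-below f j<d) ⟨
  - (f j + shift d f j)                 ∎
  where
  beyond : ∀ {x y} → y < d → x ℕ.+ y ≡ d ℕ.+ c → c < x
  beyond {x} {y} y<d e = ℕ.+-cancelˡ-< d c x (subst₂ _<_ e (ℕ.+-comm x d) (ℕ.+-monoʳ-< x y<d))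

χ₄₁-antisymmetric : ∀ m → AntisymmetricAbout (5 ℕ.+ m) (χ₄₁ m)
χ₄₁-antisymmetric m = +-shifted-antisymmetric 4 (ballot-antisymmetric m) (ballot-vanishes m)

twice : ∀ x → + 2 * x ≡ x + x
twice = solve-∀

halves : ∀ n → n ≡ n / 2 ℕ.+ n / 2 ⊎ n ≡ suc (n / 2 ℕ.+ n / 2)
halves n = by-remainder (n % 2) (m%n<n n 2) (trans (m≡m%n+[m/n]*n n 2) (cong (n % 2 ℕ.+_) (h*2≡h+h (n / 2))))
  where
  h*2≡h+h : ∀ h → h ℕ.* 2 ≡ h ℕ.+ h
  h*2≡h+h = ℕ-Solver.solve-∀
  by-remainder : ∀ r → r < 2 → n ≡ r ℕ.+ (n / 2 ℕ.+ n / 2) → n ≡ n / 2 ℕ.+ n / 2 ⊎ n ≡ suc (n / 2 ℕ.+ n / 2)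
  by-remainder 0 _ eq = inj₁ eq
  by-remainder 1 _ eq = inj₂ eq
  by-remainder (suc (suc _)) (s≤s (s≤s ())) _

square-reflect : ∀ {c f} → AntisymmetricAbout c f → ∀ i j → i ℕ.+ j ≡ c → f i * f i ≡ f j * f j
square-reflect {f = f} anti i j eq rewrite anti i j eq = neg-square (f j)
  where
  neg-square : ∀ x → (- x) * (- x) ≡ x * x
  neg-square = solve-∀

∑-square-fold-even : ∀ h {f} → AntisymmetricAbout (suc (h ℕ.+ h)) f →
  + 2 * ∑[ j < suc h ] (f j * f j) ≡ ∑[ j < suc h ℕ.+ suc h ] (f j * f j)
∑-square-fold-even h {f} anti = begin
  + 2 * ∑ (suc h) F                               ≡⟨ twice (∑ (suc h) F) ⟩
  ∑ (suc h) F + ∑ (suc h) F                       ≡⟨ cong (_+_ (∑ (suc h) F)) (∑-reverse (suc h) F _ mirror) ⟩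
  ∑ (suc h) F + ∑[ i < suc h ] F (suc h ℕ.+ i)    ≡⟨ ∑-split (suc h) (suc h) F ⟨
  ∑ (suc h ℕ.+ suc h) F                           ∎
  where
  F = λ j → f j * f j
  mirror : ∀ i j → suc (i ℕ.+ j) ≡ suc h → F i ≡ F (suc h ℕ.+ j)
  mirror i j eq = square-reflect anti i (suc h ℕ.+ j)
    (trans (regroup i h j) (cong (λ k → suc (h ℕ.+ k)) (ℕ.suc-injective eq)))
    where regroup : ∀ i h j → i ℕ.+ (suc h ℕ.+ j) ≡ suc (h ℕ.+ (i ℕ.+ j))
          regroup = ℕ-Solver.solve-∀

∑-square-fold-odd : ∀ h {f} → AntisymmetricAbout (suc (suc (h ℕ.+ h))) f →
  + 2 * ∑[ j < suc h ] (f j * f j) ≡ ∑[ j < suc h ℕ.+ suc (suc h) ] (f j * f j)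
∑-square-fold-odd h {f} anti = begin
  + 2 * ∑ (suc h) F                                   ≡⟨ twice (∑ (suc h) F) ⟩
  ∑ (suc h) F + ∑ (suc h) F                           ≡⟨ cong (_+_ (∑ (suc h) F)) (∑-reverse (suc h) F _ mirror) ⟩
  ∑ (suc h) F + ∑[ i < suc h ] F (suc h ℕ.+ suc i)    ≡⟨ cong (_+_ (∑ (suc h) F)) (ℤ.+-identityˡ _) ⟨
  ∑ (suc h) F + (+ 0 + ∑[ i < suc h ] F (suc h ℕ.+ suc i))
    ≡⟨ cong (λ x → ∑ (suc h) F + (x * x + ∑[ i < suc h ] F (suc h ℕ.+ suc i))) centre ⟨
  ∑ (suc h) F + ∑[ i < suc (suc h) ] F (suc h ℕ.+ i)  ≡⟨ ∑-split (suc h) (suc (suc h)) F ⟨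
  ∑ (suc h ℕ.+ suc (suc h)) F                         ∎
  where
  F = λ j → f j * f j
  centre : f (suc h ℕ.+ 0) ≡ + 0
  centre = antisymmetric-centre anti (regroup h)
    where regroup : ∀ h → (suc h ℕ.+ 0) ℕ.+ (suc h ℕ.+ 0) ≡ suc (suc (h ℕ.+ h))
          regroup = ℕ-Solver.solve-∀
  mirror : ∀ i j → suc (i ℕ.+ j) ≡ suc h → F i ≡ F (suc h ℕ.+ suc j)
  mirror i j eq = square-reflect anti i (suc h ℕ.+ suc j)
    (trans (regroup i h j) (cong (λ k → suc (suc (h ℕ.+ k))) (ℕ.suc-injective eq)))
    where regroup : ∀ i h j → i ℕ.+ (suc h ℕ.+ suc j) ≡ suc (suc (h ℕ.+ (i ℕ.+ j)))
          regroup = ℕ-Solver.solve-∀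

∑-square-halves : ∀ n {f} → AntisymmetricAbout (suc n) f →
  + 2 * ∑[ j < suc (n / 2) ] (f j * f j) ≡ ∑[ j < 2 ℕ.+ n ] (f j * f j)
∑-square-halves n {f} anti with halves n
... | inj₁ even = trans (∑-square-fold-even (n / 2) (subst (λ c → AntisymmetricAbout c f) (cong suc even) anti))
                        (cong (λ L → ∑[ j < L ] (f j * f j)) (trans (length-even (n / 2)) (cong (2 ℕ.+_) (sym even))))
  where length-even : ∀ h → suc h ℕ.+ suc h ≡ 2 ℕ.+ (h ℕ.+ h)
        length-even = ℕ-Solver.solve-∀
... | inj₂ odd  = trans (∑-square-fold-odd (n / 2) (subst (λ c → AntisymmetricAbout c f) (cong suc odd) anti))
                        (cong (λ L → ∑[ j < L ] (f j * f j)) (trans (length-odd (n / 2)) (cong (2 ℕ.+_) (sym odd))))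
  where length-odd : ∀ h → suc h ℕ.+ suc (suc h) ≡ 3 ℕ.+ (h ℕ.+ h)
        length-odd = ℕ-Solver.solve-∀

-- Characters of two-row shapes via beta-sets

≡ᵇ-refl : ∀ a → (a ≡ᵇ a) ≡ true
≡ᵇ-refl a = dec-true (a ≟ a) refl

≡ᵇ-false : ∀ {a b} → a ≢ b → (a ≡ᵇ b) ≡ false
≡ᵇ-false {a} {b} = dec-false (a ≟ b)

<ᵇ-true : ∀ {a b} → a < b → (a <ᵇ b) ≡ true
<ᵇ-true {a} {b} = dec-true (a <? b)

<ᵇ-false : ∀ {a b} → b ≤ a → (a <ᵇ b) ≡ false
<ᵇ-false {a} {b} b≤a = dec-false (a <? b) (ℕ.≤⇒≯ b≤a)

≤ᵇ-true : ∀ {a b} → a ≤ b → (a ≤ᵇ b) ≡ true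
≤ᵇ-true {a} {b} = dec-true (a ≤? b)

≤ᵇ-false : ∀ {a b} → b < a → (a ≤ᵇ b) ≡ false
≤ᵇ-false {a} {b} b<a = dec-false (a ≤? b) (ℕ.<⇒≱ b<a)

mem-∈ : ∀ {a S} → a ∈ S → mem a S ≡ true
mem-∈ {a} (here refl) rewrite ≡ᵇ-refl a = refl
mem-∈ {a} {x ∷ _} (there a∈S) with a ≡ᵇ x
... | true  = refl
... | false = mem-∈ a∈S

mem-∉ : ∀ {a S} → a ∉ S → mem a S ≡ false
mem-∉ {S = []}        _   = refl
mem-∉ {a} {S = x ∷ _} a∉S rewrite ≡ᵇ-false (a∉S ∘ here) = mem-∉ (a∉S ∘ there)

between-single-outside : ∀ {a b q} → q ≤ a ⊎ b ≤ q → between a b (q ∷ []) ≡ 0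
between-single-outside {a} {b} {q} (inj₁ q≤a) rewrite <ᵇ-false q≤a = refl
between-single-outside {a} {b} {q} (inj₂ b≤q) rewrite <ᵇ-false b≤q | ∧-zeroʳ (a <ᵇ q) = refl

between-single-inside : ∀ {a b q} → a < q → q < b → between a b (q ∷ []) ≡ 1
between-single-inside a<q q<b rewrite <ᵇ-true a<q | <ᵇ-true q<b = refl

rimHookTerm : ℕ → List ℕ → List ℕ → ℕ → ℤ
rimHookTerm k S μ b =
  if (k ≤ᵇ b) ∧ not (mem (b ∸ k) S)
  then sgn (between (b ∸ k) b S) * chiβ (replaceBy b (b ∸ k) S) μ
  else + 0

chiβ-∷ : ∀ k S μ → chiβ S (k ∷ μ) ≡ sumℤ (map (rimHookTerm k S μ) S)
chiβ-∷ k S μ = go S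
  where
  go : ∀ bs → sumℤ (map (λ t → proj₁ t * chiβ (proj₂ t) μ) (rims k S bs)) ≡ sumℤ (map (rimHookTerm k S μ) bs)
  go []       = refl
  go (b ∷ bs) with (k ≤ᵇ b) ∧ not (mem (b ∸ k) S)
  ... | true  = cong (_+_ (sgn (between (b ∸ k) b S) * chiβ (replaceBy b (b ∸ k) S) μ)) (go bs)
  ... | false = trans (go bs) (sym (ℤ.+-identityˡ _))

chiβ-single : ∀ k p μ → chiβ (p ∷ []) (k ∷ μ) ≡ rimHookTerm k (p ∷ []) μ p
chiβ-single k p μ = trans (chiβ-∷ k (p ∷ []) μ) (ℤ.+-identityʳ _)

chiβ-pair : ∀ k p q μ → chiβ (p ∷ q ∷ []) (k ∷ μ)
  ≡ rimHookTerm k (p ∷ q ∷ []) μ p + rimHookTerm k (p ∷ q ∷ []) μ q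
chiβ-pair k p q μ = trans (chiβ-∷ k (p ∷ q ∷ []) μ) (cong (_+_ (rimHookTerm k (p ∷ q ∷ []) μ p)) (ℤ.+-identityʳ _))

rimHookTerm-short : ∀ {k b} S μ → b < k → rimHookTerm k S μ b ≡ + 0
rimHookTerm-short S μ b<k rewrite ≤ᵇ-false b<k = refl

rimHookTerm-blocked : ∀ {k b} S μ → b ∸ k ∈ S → rimHookTerm k S μ b ≡ + 0
rimHookTerm-blocked {k} {b} S μ b-k∈S rewrite mem-∈ b-k∈S | ∧-zeroʳ (k ≤ᵇ b) = refl

rimHookTerm-free : ∀ {k b} S μ → k ≤ b → b ∸ k ∉ S →
  rimHookTerm k S μ b ≡ sgn (between (b ∸ k) b S) * chiβ (replaceBy b (b ∸ k) S) μ
rimHookTerm-free S μ k≤b b-k∉S rewrite ≤ᵇ-true k≤b | mem-∉ b-k∉S = refl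

rimHookTerm-single : ∀ {k p} μ → suc k ≤ p → rimHookTerm (suc k) (p ∷ []) μ p ≡ chiβ (p ∸ suc k ∷ []) μ
rimHookTerm-single {k} {suc p} μ (s≤s k≤p) = begin
  rimHookTerm (suc k) (suc p ∷ []) μ (suc p)
    ≡⟨ rimHookTerm-free (suc p ∷ []) μ (s≤s k≤p) (λ { (here eq) → ℕ.<⇒≢ p-k<1+p eq }) ⟩
  sgn (between (p ∸ k) (suc p) (suc p ∷ [])) * chiβ ((if suc p ≡ᵇ suc p then p ∸ k else suc p) ∷ []) μ
    ≡⟨ cong₂ (λ n c → sgn n * chiβ ((if c then p ∸ k else suc p) ∷ []) μ)
             (between-single-outside {p ∸ k} {suc p} (inj₂ ℕ.≤-refl)) (≡ᵇ-refl (suc p)) ⟩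
  + 1 * chiβ (p ∸ k ∷ []) μ
    ≡⟨ ℤ.*-identityˡ _ ⟩
  chiβ (p ∸ k ∷ []) μ ∎
  where
  p-k<1+p : p ∸ k < suc p
  p-k<1+p = s≤s (ℕ.m∸n≤m p k)

rimHookTerm-pair : ∀ {k p q} μ → suc k ≤ p → q ≢ p ∸ suc k → q ≢ p →
  rimHookTerm (suc k) (p ∷ q ∷ []) μ p ≡ sgn (between (p ∸ suc k) p (q ∷ [])) * chiβ (p ∸ suc k ∷ q ∷ []) μ
rimHookTerm-pair {k} {suc p} {q} μ (s≤s k≤p) q≢p-k q≢1+p = begin
  rimHookTerm (suc k) (suc p ∷ q ∷ []) μ (suc p)
    ≡⟨ rimHookTerm-free (suc p ∷ q ∷ []) μ (s≤s k≤p) p-k∉ ⟩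
  sgn (between (p ∸ k) (suc p) (suc p ∷ q ∷ []))
    * chiβ ((if suc p ≡ᵇ suc p then p ∸ k else suc p) ∷ (if q ≡ᵇ suc p then p ∸ k else q) ∷ []) μ
    ≡⟨ cong₂ (λ c c′ → sgn (between (p ∸ k) (suc p) (suc p ∷ q ∷ []))
                          * chiβ ((if c then p ∸ k else suc p) ∷ (if c′ then p ∸ k else q) ∷ []) μ)
             (≡ᵇ-refl (suc p)) (≡ᵇ-false q≢1+p) ⟩
  sgn (between (p ∸ k) (suc p) (suc p ∷ q ∷ [])) * chiβ (p ∸ k ∷ q ∷ []) μ
    ≡⟨ cong (λ n → sgn n * chiβ (p ∸ k ∷ q ∷ []) μ) between-tail ⟩
  sgn (between (p ∸ k) (suc p) (q ∷ [])) * chiβ (p ∸ k ∷ q ∷ []) μ ∎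
  where
  p-k<1+p : p ∸ k < suc p
  p-k<1+p = s≤s (ℕ.m∸n≤m p k)
  p-k∉ : p ∸ k ∉ suc p ∷ q ∷ []
  p-k∉ (here eq)         = ℕ.<⇒≢ p-k<1+p eq
  p-k∉ (there (here eq)) = q≢p-k (sym eq)
  between-tail : between (p ∸ k) (suc p) (suc p ∷ q ∷ []) ≡ between (p ∸ k) (suc p) (q ∷ [])
  between-tail rewrite <ᵇ-false (ℕ.≤-refl {suc p}) | ∧-zeroʳ (p ∸ k <ᵇ suc p) = refl

rimHookTerm-move : ∀ {k p q} μ → suc k ≤ p → q < p ∸ suc k ⊎ p < q →
  rimHookTerm (suc k) (p ∷ q ∷ []) μ p ≡ chiβ (p ∸ suc k ∷ q ∷ []) μ
rimHookTerm-move {k} {p} {q} μ k<p apart = begin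
  rimHookTerm (suc k) (p ∷ q ∷ []) μ p
    ≡⟨ rimHookTerm-pair μ k<p q≢p-k q≢p ⟩
  sgn (between (p ∸ suc k) p (q ∷ [])) * chiβ (p ∸ suc k ∷ q ∷ []) μ
    ≡⟨ cong (λ n → sgn n * chiβ (p ∸ suc k ∷ q ∷ []) μ) (between-single-outside outside) ⟩
  + 1 * chiβ (p ∸ suc k ∷ q ∷ []) μ
    ≡⟨ ℤ.*-identityˡ _ ⟩
  chiβ (p ∸ suc k ∷ q ∷ []) μ ∎
  where
  p-k<p : p ∸ suc k < p
  p-k<p = ℕ.∸-monoʳ-< (s≤s z≤n) k<p
  q≢p-k : q ≢ p ∸ suc k
  q≢p-k = [ ℕ.<⇒≢ , (λ p<q → ℕ.<⇒≢ (ℕ.<-trans p-k<p p<q) ∘ sym) ]′ apart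
  q≢p : q ≢ p
  q≢p = [ (λ q<p-k → ℕ.<⇒≢ (ℕ.<-trans q<p-k p-k<p)) , (λ p<q → ℕ.<⇒≢ p<q ∘ sym) ]′ apart
  outside : q ≤ p ∸ suc k ⊎ p ≤ q
  outside = [ inj₁ ∘ ℕ.<⇒≤ , inj₂ ∘ ℕ.<⇒≤ ]′ apart

rimHookTerm-cross : ∀ {k p q} μ → suc k ≤ p → p ∸ suc k < q → q < p →
  rimHookTerm (suc k) (p ∷ q ∷ []) μ p ≡ - chiβ (p ∸ suc k ∷ q ∷ []) μ
rimHookTerm-cross {k} {p} {q} μ k<p p-k<q q<p = begin
  rimHookTerm (suc k) (p ∷ q ∷ []) μ p
    ≡⟨ rimHookTerm-pair μ k<p (ℕ.<⇒≢ p-k<q ∘ sym) (ℕ.<⇒≢ q<p) ⟩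
  sgn (between (p ∸ suc k) p (q ∷ [])) * chiβ (p ∸ suc k ∷ q ∷ []) μ
    ≡⟨ cong (λ n → sgn n * chiβ (p ∸ suc k ∷ q ∷ []) μ) (between-single-inside p-k<q q<p) ⟩
  -1ℤ * chiβ (p ∸ suc k ∷ q ∷ []) μ
    ≡⟨ ℤ.-1*i≡-i _ ⟩
  - chiβ (p ∸ suc k ∷ q ∷ []) μ ∎

mem-swap : ∀ a p q → mem a (p ∷ q ∷ []) ≡ mem a (q ∷ p ∷ [])
mem-swap a p q with a ≡ᵇ p | a ≡ᵇ q
... | true  | true  = refl
... | true  | false = refl
... | false | true  = refl
... | false | false = refl

between-swap : ∀ a b p q → between a b (p ∷ q ∷ []) ≡ between a b (q ∷ p ∷ [])
between-swap a b p q with (a <ᵇ p) ∧ (p <ᵇ b) | (a <ᵇ q) ∧ (q <ᵇ b)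
... | true  | true  = refl
... | true  | false = refl
... | false | true  = refl
... | false | false = refl

chiβ-swap : ∀ p q μ → chiβ (p ∷ q ∷ []) μ ≡ chiβ (q ∷ p ∷ []) μ
rimHookTerm-swap : ∀ k p q μ b → rimHookTerm k (p ∷ q ∷ []) μ b ≡ rimHookTerm k (q ∷ p ∷ []) μ b

chiβ-swap p q [] = cong (λ t → if 2 ℕ.* t ≡ᵇ 2 then + 1 else + 0) (sum-swap p q)
  where
  sum-swap : ∀ p q → p ℕ.+ (q ℕ.+ 0) ≡ q ℕ.+ (p ℕ.+ 0)
  sum-swap = ℕ-Solver.solve-∀
chiβ-swap p q (k ∷ μ) = begin
  chiβ (p ∷ q ∷ []) (k ∷ μ)                     ≡⟨ chiβ-pair k p q μ ⟩
  term (p ∷ q ∷ []) p + term (p ∷ q ∷ []) q     ≡⟨ ℤ.+-comm (term (p ∷ q ∷ []) p) _ ⟩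
  term (p ∷ q ∷ []) q + term (p ∷ q ∷ []) p     ≡⟨ cong₂ _+_ (rimHookTerm-swap k p q μ q) (rimHookTerm-swap k p q μ p) ⟩
  term (q ∷ p ∷ []) q + term (q ∷ p ∷ []) p     ≡⟨ chiβ-pair k q p μ ⟨
  chiβ (q ∷ p ∷ []) (k ∷ μ)                     ∎
  where
  term = λ S → rimHookTerm k S μ

rimHookTerm-swap k p q μ b =
  cong₂ (λ c t → if (k ≤ᵇ b) ∧ not c then t else + 0) (mem-swap (b ∸ k) p q)
        (cong₂ (λ n χ′ → sgn n * χ′) (between-swap (b ∸ k) b p q)
               (chiβ-swap (if p ≡ᵇ b then b ∸ k else p) (if q ≡ᵇ b then b ∸ k else q) μ))

ballot-suc : ∀ s q → ballot (suc s) q ≡ ballot s q + shift 1 (ballot s) q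
ballot-suc s zero    = trans (cong (_- + 0) (row-0 (suc s))) (sym (cong (λ x → (x - + 0) + + 0) (row-0 s)))
ballot-suc s (suc q) = begin
  row (suc s) (suc q) - row (suc s) q                   ≡⟨ cong₂ _-_ (row-suc s (suc q)) (row-suc s q) ⟩
  (row s (suc q) + row s q) - (row s q + shift 1 (row s) q) ≡⟨ telescope (row s (suc q)) (row s q) (shift 1 (row s) q) ⟩
  (row s (suc q) - row s q) + (row s q - shift 1 (row s) q) ∎
  where
  telescope : ∀ a b c → (a + b) - (b + c) ≡ (a - b) + (b - c)
  telescope = solve-∀

chiβ-ones : ∀ s p q → q < p → p ℕ.+ q ≡ suc s → chiβ (p ∷ q ∷ []) (replicate s 1) ≡ ballot s q
chiβ-ones zero    (suc zero)    zero    _   _  = refl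
chiβ-ones zero    (suc zero)    (suc q) _   ()
chiβ-ones zero    (suc (suc p)) q       _   ()
chiβ-ones (suc s) (suc p)       q       q<p eq = begin
  chiβ (suc p ∷ q ∷ []) (1 ∷ μ)                         ≡⟨ chiβ-pair 1 (suc p) q μ ⟩
  rimHookTerm 1 S μ (suc p) + rimHookTerm 1 S μ q       ≡⟨ cong₂ _+_ (upper (p ℕ.≟ q)) (lower q q<p eq) ⟩
  ballot s q + shift 1 (ballot s) q                     ≡⟨ ballot-suc s q ⟨
  ballot (suc s) q                                      ∎
  where
  μ = replicate s 1
  S = suc p ∷ q ∷ []
  p+q≡1+s : p ℕ.+ q ≡ suc s
  p+q≡1+s = ℕ.suc-injective eq
  upper : Dec (p ≡ q) → rimHookTerm 1 S μ (suc p) ≡ ballot s q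
  upper (yes refl) = trans (rimHookTerm-blocked {1} {suc p} S μ (there (here refl)))
                           (sym (antisymmetric-centre (ballot-antisymmetric s) {p} p+q≡1+s))
  upper (no p≢q)   = begin
    rimHookTerm 1 S μ (suc p)   ≡⟨ rimHookTerm-move μ (s≤s z≤n) (inj₁ q<p′) ⟩
    chiβ (p ∷ q ∷ []) μ         ≡⟨ chiβ-ones s p q q<p′ p+q≡1+s ⟩
    ballot s q                  ∎
    where q<p′ = ℕ.≤∧≢⇒< (ℕ.≤-pred q<p) (p≢q ∘ sym)
  lower : ∀ q → q < suc p → suc p ℕ.+ q ≡ suc (suc s) → rimHookTerm 1 (suc p ∷ q ∷ []) μ q ≡ shift 1 (ballot s) q
  lower zero    _   _  = rimHookTerm-short {1} {0} (suc p ∷ 0 ∷ []) μ (s≤s z≤n)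
  lower (suc q) 1+q<1+p eq = begin
    rimHookTerm 1 (suc p ∷ suc q ∷ []) μ (suc q)  ≡⟨ rimHookTerm-swap 1 (suc p) (suc q) μ (suc q) ⟩
    rimHookTerm 1 (suc q ∷ suc p ∷ []) μ (suc q)  ≡⟨ rimHookTerm-move μ (s≤s z≤n) (inj₂ 1+q<1+p) ⟩
    chiβ (q ∷ suc p ∷ []) μ                       ≡⟨ chiβ-swap q (suc p) μ ⟩
    chiβ (suc p ∷ q ∷ []) μ                       ≡⟨ chiβ-ones s (suc p) q (ℕ.<-trans (ℕ.n<1+n q) 1+q<1+p)
                                                                (trans (sym (ℕ.+-suc p q)) (ℕ.suc-injective eq)) ⟩
    ballot s q                                    ∎

chiβ-single-ones : ∀ p → chiβ (p ∷ []) (replicate p 1) ≡ + 1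
chiβ-single-ones zero    = refl
chiβ-single-ones (suc p) =
  trans (chiβ-single 1 (suc p) (replicate p 1))
        (trans (rimHookTerm-single (replicate p 1) (s≤s z≤n)) (chiβ-single-ones p))

rimHookTerm-41-outer : ∀ m p q → q < p → p ℕ.+ q ≡ 5 ℕ.+ m →
  rimHookTerm 4 (p ∷ q ∷ []) (replicate m 1) p ≡ ballot m q
rimHookTerm-41-outer m p q q<p eq with p <? 4
... | yes p<4 = trans (rimHookTerm-short S μ p<4) (sym (ballot-vanishes m 1+m<q))
  where
  μ = replicate m 1
  S = p ∷ q ∷ []
  1+m<q = ℕ.+-cancelˡ-< 4 (suc m) q (subst (_< 4 ℕ.+ q) eq (ℕ.+-monoˡ-< q p<4))
... | no p≮4 = from-cmp (ℕ.<-cmp (p ∸ 4) q)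
  where
  μ = replicate m 1
  S = p ∷ q ∷ []
  4≤p = ℕ.≮⇒≥ p≮4
  p′+q≡1+m : p ∸ 4 ℕ.+ q ≡ suc m
  p′+q≡1+m = cancel-shiftˡ 4 (p ∸ 4) q (trans (cong (ℕ._+ q) (ℕ.m+[n∸m]≡n 4≤p)) eq)
  from-cmp : Tri (p ∸ 4 < q) (p ∸ 4 ≡ q) (q < p ∸ 4) → rimHookTerm 4 S μ p ≡ ballot m q
  from-cmp (tri≈ _ p′≡q _) = trans (rimHookTerm-blocked {4} {p} S μ (there (here p′≡q)))
    (sym (antisymmetric-centre (ballot-antisymmetric m) {q} (subst (λ p′ → p′ ℕ.+ q ≡ suc m) p′≡q p′+q≡1+m)))
  from-cmp (tri> _ _ q<p′) = trans (rimHookTerm-move μ 4≤p (inj₁ q<p′)) (chiβ-ones m (p ∸ 4) q q<p′ p′+q≡1+m)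
  -- the hook crosses the bead q; its sign is absorbed by the antisymmetry of ballot m
  from-cmp (tri< p′<q _ _) = begin
    rimHookTerm 4 S μ p              ≡⟨ rimHookTerm-cross μ 4≤p p′<q q<p ⟩
    - chiβ (p ∸ 4 ∷ q ∷ []) μ        ≡⟨ cong -_ (chiβ-swap (p ∸ 4) q μ) ⟩
    - chiβ (q ∷ p ∸ 4 ∷ []) μ        ≡⟨ cong -_ (chiβ-ones m q (p ∸ 4) p′<q q+p′≡1+m) ⟩
    - ballot m (p ∸ 4)               ≡⟨ ballot-antisymmetric m q (p ∸ 4) q+p′≡1+m ⟨
    ballot m q                       ∎
    where q+p′≡1+m = trans (ℕ.+-comm q (p ∸ 4)) p′+q≡1+m

rimHookTerm-41-inner : ∀ m p q → q < p → p ℕ.+ q ≡ 5 ℕ.+ m →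
  rimHookTerm 4 (p ∷ q ∷ []) (replicate m 1) q ≡ shift 4 (ballot m) q
rimHookTerm-41-inner m p q q<p eq with shiftView 4 q
... | below q<4 = trans (rimHookTerm-short (p ∷ q ∷ []) (replicate m 1) q<4) (sym (shift-below (ballot m) q<4))
... | above q′  = begin
  rimHookTerm 4 (p ∷ 4 ℕ.+ q′ ∷ []) μ (4 ℕ.+ q′)  ≡⟨ rimHookTerm-swap 4 p (4 ℕ.+ q′) μ (4 ℕ.+ q′) ⟩
  rimHookTerm 4 (4 ℕ.+ q′ ∷ p ∷ []) μ (4 ℕ.+ q′)  ≡⟨ rimHookTerm-move μ (ℕ.m≤m+n 4 q′) (inj₂ q<p) ⟩
  chiβ (q′ ∷ p ∷ []) μ                             ≡⟨ chiβ-swap q′ p μ ⟩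
  chiβ (p ∷ q′ ∷ []) μ                             ≡⟨ chiβ-ones m p q′ (ℕ.<-trans (ℕ.m<n+m q′ (s≤s z≤n)) q<p)
                                                                (cancel-shiftʳ 4 p q′ eq) ⟩
  ballot m q′                                      ∎
  where μ = replicate m 1

chiβ-pair-41 : ∀ m p q → q < p → p ℕ.+ q ≡ 5 ℕ.+ m → chiβ (p ∷ q ∷ []) (4 ∷ replicate m 1) ≡ χ₄₁ m q
chiβ-pair-41 m p q q<p eq =
  trans (chiβ-pair 4 p q (replicate m 1)) (cong₂ _+_ (rimHookTerm-41-outer m p q q<p eq) (rimHookTerm-41-inner m p q q<p eq))

χ-twoRow-41 : ∀ m j → j ℕ.+ j ≤ 4 ℕ.+ m → χ (twoRow (4 ℕ.+ m) j) (cycleType41 (4 ℕ.+ m)) ≡ χ₄₁ m j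
χ-twoRow-41 m zero _ = begin
  chiβ ((4 ℕ.+ m) ℕ.+ 0 ∷ []) (4 ∷ μ)   ≡⟨ cong (λ p → chiβ (p ∷ []) (4 ∷ μ)) (ℕ.+-identityʳ (4 ℕ.+ m)) ⟩
  chiβ (4 ℕ.+ m ∷ []) (4 ∷ μ)           ≡⟨ chiβ-single 4 (4 ℕ.+ m) μ ⟩
  rimHookTerm 4 (4 ℕ.+ m ∷ []) μ (4 ℕ.+ m) ≡⟨ rimHookTerm-single μ (ℕ.m≤m+n 4 m) ⟩
  chiβ (m ∷ []) μ                       ≡⟨ chiβ-single-ones m ⟩
  + 1                                   ≡⟨ cong (λ x → (x - + 0) + + 0) (row-0 m) ⟨
  χ₄₁ m 0                               ∎
  where μ = replicate m 1
χ-twoRow-41 m (suc j) 2j≤n = begin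
  chiβ (p ∷ suc j ℕ.+ 0 ∷ []) (4 ∷ μ)   ≡⟨ cong (λ q → chiβ (p ∷ q ∷ []) (4 ∷ μ)) (ℕ.+-identityʳ (suc j)) ⟩
  chiβ (p ∷ suc j ∷ []) (4 ∷ μ)         ≡⟨ chiβ-pair-41 m p (suc j) q<p p+q≡ ⟩
  χ₄₁ m (suc j)                         ∎
  where
  μ = replicate m 1
  n = 4 ℕ.+ m
  p = (n ∸ suc j) ℕ.+ 1
  j<n-j : suc j ≤ n ∸ suc j
  j<n-j = ℕ.m+n≤o⇒m≤o∸n (suc j) 2j≤n
  q<p : suc j < p
  q<p = subst (suc j <_) (ℕ.+-comm 1 (n ∸ suc j)) (s≤s j<n-j)
  p+q≡ : p ℕ.+ suc j ≡ 5 ℕ.+ m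
  p+q≡ = trans (regroup (n ∸ suc j) j) (cong suc (ℕ.m∸n+n≡m (ℕ.m+n≤o⇒m≤o (suc j) 2j≤n)))
    where regroup : ∀ a j → (a ℕ.+ 1) ℕ.+ suc j ≡ suc (a ℕ.+ suc j)
          regroup = ℕ-Solver.solve-∀

half+half≤ : ∀ n → n / 2 ℕ.+ n / 2 ≤ n
half+half≤ n with halves n
... | inj₁ even = ℕ.≤-reflexive (sym even)
... | inj₂ odd  = ℕ.≤-trans (ℕ.n≤1+n _) (ℕ.≤-reflexive (sym odd))

lhsSum-χ₄₁ : ∀ m → + 2 * lhsSum (4 ℕ.+ m) ≡ ∑[ j < 6 ℕ.+ m ] (χ₄₁ m j * χ₄₁ m j)
lhsSum-χ₄₁ m = begin
  + 2 * lhsSum n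
    ≡⟨ cong (+ 2 *_) (∑-upTo (suc (n / 2)) (λ j → χ (twoRow n j) (cycleType41 n) * χ (twoRow n j) (cycleType41 n))) ⟩
  + 2 * ∑[ j < suc (n / 2) ] (χ (twoRow n j) (cycleType41 n) * χ (twoRow n j) (cycleType41 n))
    ≡⟨ cong (+ 2 *_) (∑-cong-< (suc (n / 2)) (λ j≤h → cong₂ _*_ (χ-j j≤h) (χ-j j≤h))) ⟩
  + 2 * ∑[ j < suc (n / 2) ] (χ₄₁ m j * χ₄₁ m j)
    ≡⟨ ∑-square-halves n (χ₄₁-antisymmetric m) ⟩
  ∑[ j < 6 ℕ.+ m ] (χ₄₁ m j * χ₄₁ m j) ∎
  where
  n = 4 ℕ.+ m
  χ-j : ∀ {j} → j < suc (n / 2) → χ (twoRow n j) (cycleType41 n) ≡ χ₄₁ m j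
  χ-j {j} (s≤s j≤h) = χ-twoRow-41 m j (ℕ.≤-trans (ℕ.+-mono-≤ j≤h j≤h) (half+half≤ n))

-- Binomial ratios and the closed form

∏ : ℕ → (ℕ → ℤ) → ℤ
∏ zero    f = + 1
∏ (suc k) f = f 0 * ∏ k (f ∘ suc)

telescope : ∀ (x a b : ℕ → ℤ) → (∀ i → x (suc i) * a i ≡ x i * b i) → ∀ k → x k * ∏ k a ≡ x 0 * ∏ k b
telescope x a b step zero    = refl
telescope x a b step (suc k) = begin
  x (suc k) * (a 0 * ∏ k (a ∘ suc))  ≡⟨ swap (x (suc k)) (a 0) (∏ k (a ∘ suc)) ⟩
  a 0 * (x (suc k) * ∏ k (a ∘ suc))  ≡⟨ cong (a 0 *_) (telescope (x ∘ suc) (a ∘ suc) (b ∘ suc) (step ∘ suc) k) ⟩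
  a 0 * (x 1 * ∏ k (b ∘ suc))        ≡⟨ ℤ.*-assoc (a 0) (x 1) _ ⟨
  (a 0 * x 1) * ∏ k (b ∘ suc)        ≡⟨ cong (_* ∏ k (b ∘ suc)) (trans (ℤ.*-comm (a 0) (x 1)) (step 0)) ⟩
  (x 0 * b 0) * ∏ k (b ∘ suc)        ≡⟨ ℤ.*-assoc (x 0) (b 0) _ ⟩
  x 0 * (b 0 * ∏ k (b ∘ suc))        ∎
  where
  swap : ∀ u v w → u * (v * w) ≡ v * (u * w)
  swap = solve-∀

row-absorption : ∀ n k → + suc k * row (suc n) (suc k) ≡ + suc n * row n k
row-absorption zero    zero    = refl
row-absorption zero    (suc k) = ℤ.*-zeroʳ (+ suc (suc k))
row-absorption (suc n) zero    = begin
  + 1 * row (suc (suc n)) 1   ≡⟨ ℤ.*-identityˡ _ ⟩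
  + (suc (suc n) C 1)         ≡⟨ cong +_ (nC1≡n (suc (suc n))) ⟩
  + suc (suc n)               ≡⟨ ℤ.*-identityʳ _ ⟨
  + suc (suc n) * + 1         ≡⟨ cong (+ suc (suc n) *_) (row-0 (suc n)) ⟨
  + suc (suc n) * row (suc n) 0 ∎
row-absorption (suc n) (suc k) = begin
  (+ 1 + K) * row (suc (suc n)) (suc (suc k))  ≡⟨ cong ((+ 1 + K) *_) (row-pascal (suc n) (suc k)) ⟩
  (+ 1 + K) * (x + y)                           ≡⟨ split K x y ⟩
  x + (K * x + (+ 1 + K) * y)                   ≡⟨ cong (_+_ x) (cong₂ _+_ (row-absorption n k) (row-absorption n (suc k))) ⟩
  x + (N * row n k + N * row n (suc k))         ≡⟨ cong (_+_ x) (ℤ.*-distribˡ-+ N (row n k) _) ⟨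
  x + N * (row n k + row n (suc k))             ≡⟨ cong (λ z → x + N * z) (row-pascal n k) ⟨
  x + N * x                                     ≡⟨ gather N x ⟩
  (+ 1 + N) * x                                 ∎
  where
  K = + suc k
  N = + suc n
  x = row (suc n) (suc k)
  y = row (suc n) (suc (suc k))
  split : ∀ K x y → (+ 1 + K) * (x + y) ≡ x + (K * x + (+ 1 + K) * y)
  split = solve-∀
  gather : ∀ N x → x + N * x ≡ (+ 1 + N) * x
  gather = solve-∀

row-ratio : ∀ n k → row n (suc k) * + suc k ≡ row n k * (+ n - + k)
row-ratio n k = begin
  row n (suc k) * + suc k                                  ≡⟨ isolate (+ k) (row n k) (row n (suc k)) ⟩
  + suc k * (row n k + row n (suc k)) - + suc k * row n k  ≡⟨ cong (λ z → + suc k * z - + suc k * row n k) (row-pascal n k) ⟨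
  + suc k * row (suc n) (suc k) - + suc k * row n k        ≡⟨ cong (_- + suc k * row n k) (row-absorption n k) ⟩
  + suc n * row n k - + suc k * row n k                    ≡⟨ factor (+ n) (+ k) (row n k) ⟩
  row n k * (+ n - + k)                                    ∎
  where
  isolate : ∀ K x y → y * (+ 1 + K) ≡ (+ 1 + K) * (x + y) - (+ 1 + K) * x
  isolate = solve-∀
  factor : ∀ N K x → (+ 1 + N) * x - (+ 1 + K) * x ≡ x * (N - K)
  factor = solve-∀

centred-ratio : ∀ m k → centred m (suc k) * (+ suc k + + m) ≡ centred m k * (+ m - + k)
centred-ratio m k = begin
  row (m ℕ.+ m) (m ℕ.+ suc k) * + suc (k ℕ.+ m)
    ≡⟨ cong₂ (λ i j → row (m ℕ.+ m) i * + suc j) (ℕ.+-suc m k) (ℕ.+-comm k m) ⟩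
  row (m ℕ.+ m) (suc (m ℕ.+ k)) * + suc (m ℕ.+ k)
    ≡⟨ row-ratio (m ℕ.+ m) (m ℕ.+ k) ⟩
  row (m ℕ.+ m) (m ℕ.+ k) * ((+ m + + m) - (+ m + + k))
    ≡⟨ cong (row (m ℕ.+ m) (m ℕ.+ k) *_) (cancel (+ m) (+ k)) ⟩
  centred m k * (+ m - + k) ∎
  where
  cancel : ∀ M K → (M + M) - (M + K) ≡ M - K
  cancel = solve-∀

central : ℕ → ℤ
central n = row (2 ℕ.* n) n

central≡centred : ∀ m → central m ≡ centred m 0
central≡centred m = cong₂ (λ i j → row (m ℕ.+ i) j) (ℕ.+-identityʳ m) (sym (ℕ.+-identityʳ m))

central-ratio : ∀ n → central (suc n) * + suc n ≡ central n * (+ 2 * (+ 2 * + n + + 1))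
central-ratio n = begin
  central (suc n) * + suc n                  ≡⟨ cong (λ t → row t (suc n) * + suc n) (cong suc (ℕ.+-suc n (n ℕ.+ 0))) ⟩
  row (2 ℕ.+ t) (suc n) * + suc n            ≡⟨ ℤ.*-comm (row (2 ℕ.+ t) (suc n)) _ ⟩
  + suc n * row (2 ℕ.+ t) (suc n)            ≡⟨ row-absorption (suc t) n ⟩
  + (2 ℕ.+ t) * row (suc t) n                ≡⟨ cong (+ (2 ℕ.+ t) *_) (row-symmetric n (suc n) n+1+n≡1+t) ⟩
  + (2 ℕ.+ t) * row (suc t) (suc n)          ≡⟨ double (+ n) (row (suc t) (suc n)) ⟩
  + 2 * (+ suc n * row (suc t) (suc n))      ≡⟨ cong (+ 2 *_) (row-absorption t n) ⟩
  + 2 * (+ suc t * row t n)                  ≡⟨ reorder (+ n) (row t n) ⟩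
  central n * (+ 2 * (+ 2 * + n + + 1))     ∎
  where
  t = 2 ℕ.* n
  n+1+n≡1+t : n ℕ.+ suc n ≡ suc t
  n+1+n≡1+t = trans (ℕ.+-suc n n) (cong (λ i → suc (n ℕ.+ i)) (sym (ℕ.+-identityʳ n)))
  double : ∀ N x → (+ 2 + (N + (N + + 0))) * x ≡ + 2 * ((+ 1 + N) * x)
  double = solve-∀
  reorder : ∀ N x → + 2 * ((+ 1 + (N + (N + + 0))) * x) ≡ x * (+ 2 * (+ 2 * N + + 1))
  reorder = solve-∀

risingFactor fallingFactor centralFactor : ℕ → ℕ → ℤ
risingFactor  m i = + suc i + + m
fallingFactor m i = + m - + i
centralFactor m i = + 2 * (+ 2 * (+ i + + m) + + 1)

closed-form : ∀ m (L c₀ c₁ c₃ c₄ c₅ y : ℤ) → let N = + 4 + + m in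
  + 2 * L ≡ + 4 * c₀ - + 4 * c₁ - + 2 * c₃ + + 4 * c₄ - + 2 * c₅ →
  c₁ * ∏ 1 (risingFactor m) ≡ c₀ * ∏ 1 (fallingFactor m) →
  c₃ * ∏ 3 (risingFactor m) ≡ c₀ * ∏ 3 (fallingFactor m) →
  c₄ * ∏ 4 (risingFactor m) ≡ c₀ * ∏ 4 (fallingFactor m) →
  c₅ * ∏ 5 (risingFactor m) ≡ c₀ * ∏ 5 (fallingFactor m) →
  y * ∏ 4 (risingFactor m) ≡ c₀ * ∏ 4 (centralFactor m) →
  + 4 * (+ 2 * N - + 1) * (+ 2 * N - + 3) * (+ 2 * N - + 5) * (+ 2 * N - + 7) * (N + + 1) * L
    ≡ (N ^ 4 - + 26 * N ^ 3 + + 299 * N ^ 2 - + 1354 * N + + 2100) * y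
closed-form m L c₀ c₁ c₃ c₄ c₅ y hL h₁ h₃ h₄ h₅ hy =
  ℤ.*-cancelʳ-≡ _ _ (+ 2 * R₅) (ℤ.i-j≡0⇒i≡j _ _ (trans (certificate (+ m) L c₀ c₁ c₃ c₄ c₅ y)
    (combination-zero (A * R₅) (- (+ 4 * A * ((+ 2 + M) * (+ 3 + M) * (+ 4 + M) * (+ 5 + M))))
                      (- (+ 2 * A * ((+ 4 + M) * (+ 5 + M)))) (+ 4 * A * (+ 5 + M)) (- (+ 2 * A))
                      (- (+ 2 * P * (+ 5 + M)))
                      (ℤ.i≡j⇒i-j≡0 hL) (ℤ.i≡j⇒i-j≡0 h₁) (ℤ.i≡j⇒i-j≡0 h₃)
                      (ℤ.i≡j⇒i-j≡0 h₄) (ℤ.i≡j⇒i-j≡0 h₅) (ℤ.i≡j⇒i-j≡0 hy))))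
  where
  M = + m
  N = + 4 + M
  A = + 4 * (+ 2 * N - + 1) * (+ 2 * N - + 3) * (+ 2 * N - + 5) * (+ 2 * N - + 7) * (N + + 1)
  P = N * (N * (N * (N * + 1))) - + 26 * (N * (N * (N * + 1))) + + 299 * (N * (N * + 1)) - + 1354 * N + + 2100
  R₅ = (+ 1 + M) * ((+ 2 + M) * ((+ 3 + M) * ((+ 4 + M) * ((+ 5 + M) * + 1))))
  combination-zero : ∀ a b c d e f {x₁ x₂ x₃ x₄ x₅ x₆ : ℤ} →
    x₁ ≡ + 0 → x₂ ≡ + 0 → x₃ ≡ + 0 → x₄ ≡ + 0 → x₅ ≡ + 0 → x₆ ≡ + 0 →
    a * x₁ + (b * x₂ + (c * x₃ + (d * x₄ + (e * x₅ + f * x₆)))) ≡ + 0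
  combination-zero a b c d e f refl refl refl refl refl refl = zeros a b c d e f
    where
    zeros : ∀ a b c d e f → a * + 0 + (b * + 0 + (c * + 0 + (d * + 0 + (e * + 0 + f * + 0)))) ≡ + 0
    zeros = solve-∀
  -- (A L - P y)·2R₅ as an explicit combination of the hypotheses; R₅ > 0 is then cancelled.
  certificate : ∀ M L c₀ c₁ c₃ c₄ c₅ y →
    let N  = + 4 + M
        A  = + 4 * (+ 2 * N - + 1) * (+ 2 * N - + 3) * (+ 2 * N - + 5) * (+ 2 * N - + 7) * (N + + 1)
        P  = N * (N * (N * (N * + 1))) - + 26 * (N * (N * (N * + 1))) + + 299 * (N * (N * + 1)) - + 1354 * N + + 2100
        R₁ = (+ 1 + M) * + 1
        R₃ = (+ 1 + M) * ((+ 2 + M) * ((+ 3 + M) * + 1))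
        R₄ = (+ 1 + M) * ((+ 2 + M) * ((+ 3 + M) * ((+ 4 + M) * + 1)))
        R₅ = (+ 1 + M) * ((+ 2 + M) * ((+ 3 + M) * ((+ 4 + M) * ((+ 5 + M) * + 1))))
        F₁ = (M - + 0) * + 1
        F₃ = (M - + 0) * ((M - + 1) * ((M - + 2) * + 1))
        F₄ = (M - + 0) * ((M - + 1) * ((M - + 2) * ((M - + 3) * + 1)))
        F₅ = (M - + 0) * ((M - + 1) * ((M - + 2) * ((M - + 3) * ((M - + 4) * + 1))))
        Y₄ = (+ 2 * (+ 2 * (+ 0 + M) + + 1)) * ((+ 2 * (+ 2 * (+ 1 + M) + + 1))
             * ((+ 2 * (+ 2 * (+ 2 + M) + + 1)) * ((+ 2 * (+ 2 * (+ 3 + M) + + 1)) * + 1)))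
    in (A * L) * (+ 2 * R₅) - (P * y) * (+ 2 * R₅)
       ≡ A * R₅ * (+ 2 * L - (+ 4 * c₀ - + 4 * c₁ - + 2 * c₃ + + 4 * c₄ - + 2 * c₅))
         + (- (+ 4 * A * ((+ 2 + M) * (+ 3 + M) * (+ 4 + M) * (+ 5 + M))) * (c₁ * R₁ - c₀ * F₁)
         + (- (+ 2 * A * ((+ 4 + M) * (+ 5 + M))) * (c₃ * R₃ - c₀ * F₃)
         + (+ 4 * A * (+ 5 + M) * (c₄ * R₄ - c₀ * F₄)
         + (- (+ 2 * A) * (c₅ * R₅ - c₀ * F₅)
         + - (+ 2 * P * (+ 5 + M)) * (y * R₄ - c₀ * Y₄)))))
  certificate = solve-∀

mainTheorem13 : (n : ℕ) → 4 ≤ n →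
    (+ 4) * ((+ 2) * (+ n) - + 1) * ((+ 2) * (+ n) - + 3) * ((+ 2) * (+ n) - + 5) * ((+ 2) * (+ n) - + 7) * ((+ n) + + 1) * lhsSum n
      ≡ ((+ n) ^ 4 - (+ 26) * (+ n) ^ 3 + (+ 299) * (+ n) ^ 2 - (+ 1354) * (+ n) + + 2100) * (+ ((2 Data.Nat.* n) C n))
mainTheorem13 (suc (suc (suc (suc m)))) (s≤s (s≤s (s≤s (s≤s z≤n)))) =
  closed-form m (lhsSum (4 ℕ.+ m)) (c 0) (c 1) (c 3) (c 4) (c 5) (central (4 ℕ.+ m))
    (trans (lhsSum-χ₄₁ m) (∑-χ₄₁² m))
    (ratios 1) (ratios 3) (ratios 4) (ratios 5)
    (trans (telescope (λ i → central (i ℕ.+ m)) (risingFactor m) (centralFactor m) (λ i → central-ratio (i ℕ.+ m)) 4)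
           (cong (_* ∏ 4 (centralFactor m)) (central≡centred m)))
  where
  c = centred m
  ratios : ∀ k → c k * ∏ k (risingFactor m) ≡ c 0 * ∏ k (fallingFactor m)
  ratios = telescope c (risingFactor m) (fallingFactor m) (centred-ratio m)
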